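{- In the Lie algebra of type $B_r$, let $\ell$ be an integer with $3\le \ell\le r$ and let $x,y$ be positive integers. Then \[\wp_q(x\alpha_1+y\alpha_2+\alpha_3+\alpha_4+\cdots+\alpha_\ell)=q(1+q)^{\ell-3}\left[\langle x-1,y-1\rangle+\langle x,y-1\rangle+\langle x,y\rangle\right],\] where $\langle m,n\rangle:=\wp_q(m\alpha_1+n\alpha_2)$ for nonnegative integers $m,n$.
   Context: Type $B_r$ in $\mathbb{R}^r$: simple roots $\alpha_i=\varepsilon_i-\varepsilon_{i+1}$ ($i<r$), $\alpha_r=\varepsilon_r$; positive roots $\varepsilon_i\pm\varepsilon_j$ ($1\le i<j\le r$) and $\varepsilon_i$. For a weight $\xi$, $\wp_q(\xi)=\sum_{j\ge0}c_jq^j$, where $c_j$ is the number of ways to write $\xi$ as a nonnegative integral sum of exactly $j$ positive roots (counted with multiplicity). The upper bound $\ell\le r$ is only so that $\alpha_\ell$ is defined. -}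

module Defs where

open import Data.Bool using (Bool; true; false; if_then_else_)
open import Data.Nat as ℕ using (ℕ; zero; suc; _∸_; _<ᵇ_; _≡ᵇ_)
open import Data.Integer as ℤ using (ℤ; +_)
open import Data.Fin using (Fin; toℕ)
open import Data.Fin.Properties using () renaming (_≟_ to _≟ᶠ_)
open import Data.List using (List; []; _∷_; _++_; concatMap; allFin; map; foldr)
open import Data.Vec as V using (Vec; tabulate; zipWith; replicate)
open import Data.Vec.Properties using (≡-dec)
open import Relation.Nullary.Decidable using (⌊_⌋)

-- Weights of B_r in ε-coordinates (ε_1,…,ε_r ↦ Fin r, 0-based).
Weight : ℕ → Set
Weight r = Vec ℤ r

𝟘 : ∀ {r} → Weight r
𝟘 = replicate _ (+ 0)

_⊕ʷ_ _⊖ʷ_ : ∀ {r} → Weight r → Weight r → Weight r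
_⊕ʷ_ = zipWith ℤ._+_
_⊖ʷ_ = zipWith ℤ._-_

scale : ∀ {r} → ℤ → Weight r → Weight r
scale k = V.map (k ℤ.*_)

ε : ∀ {r} → Fin r → Weight r
ε i = tabulate λ j → if ⌊ i ≟ᶠ j ⌋ then + 1 else + 0

-- simple roots: α_i = ε_i − ε_{i+1} (i < r), α_r = ε_r (0-based index i)
α : ∀ {r} → Fin r → Weight r
α i = ε i ⊖ʷ tabulate (λ j → if toℕ j ≡ᵇ suc (toℕ i) then + 1 else + 0)

combo : ∀ {r} → (Fin r → ℕ) → Weight r
combo {r} c = foldr (λ i acc → scale (+ c i) (α i) ⊕ʷ acc) 𝟘 (allFin r)

posRoots : ∀ r → List (Weight r)
posRoots r =
  concatMap (λ i → concatMap (λ j →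
     if toℕ i <ᵇ toℕ j then (ε i ⊖ʷ ε j) ∷ (ε i ⊕ʷ ε j) ∷ [] else [])
     (allFin r)) (allFin r)
  ++ map ε (allFin r)

sumTo : ℕ → (ℕ → ℕ) → ℕ
sumTo zero f = f 0
sumTo (suc n) f = sumTo n f ℕ.+ f (suc n)

-- ways βs j ξ = number of multiplicity assignments m : βs → ℕ with
-- Σ m(β) = j and Σ m(β)·β = ξ (i.e. ways to write ξ as a sum of exactly j
-- roots from the list βs, counted as multisets).
ways : ∀ {r} → List (Weight r) → ℕ → Weight r → ℕ
ways [] zero ξ = if ⌊ ≡-dec ℤ._≟_ ξ 𝟘 ⌋ then 1 else 0
ways [] (suc j) ξ = 0
ways (β ∷ βs) j ξ = sumTo j (λ k → ways βs (j ∸ k) (ξ ⊖ʷ scale (+ k) β))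

-- Polynomials in q with ℕ coefficients, as coefficient sequences.
Poly : Set
Poly = ℕ → ℕ

-- q-analog of Kostant's partition function for B_r: coefficient of q^j.
℘ : ∀ r → Weight r → Poly
℘ r ξ j = ways (posRoots r) j ξ

_⊕_ : Poly → Poly → Poly
(f ⊕ g) n = f n ℕ.+ g n

_⊛_ : Poly → Poly → Poly
(f ⊛ g) n = sumTo n (λ i → f i ℕ.* g (n ∸ i))

𝟙 : Poly
𝟙 zero = 1
𝟙 (suc _) = 0

q : Poly
q 1 = 1
q _ = 0

_^ᵖ_ : Poly → ℕ → Poly
p ^ᵖ zero = 𝟙
p ^ᵖ suc n = p ⊛ (p ^ᵖ n)

-- coefficients of x α_1 + y α_2 + α_3 + ⋯ + α_ℓ
coeffℓ : ℕ → ℕ → ℕ → ℕ → ℕ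
coeffℓ x y ℓ zero = x
coeffℓ x y ℓ (suc zero) = y
coeffℓ x y ℓ (suc (suc k)) = if suc (suc k) <ᵇ ℓ then 1 else 0

coeff₂ : ℕ → ℕ → ℕ → ℕ
coeff₂ m n zero = m
coeff₂ m n (suc zero) = n
coeff₂ m n (suc (suc _)) = 0

⟨_,_⟩ : ∀ {r} → ℕ → ℕ → Poly
⟨_,_⟩ {r} m n = ℘ r (combo (λ i → coeff₂ m n (toℕ i)))

-- Write ξ_ℓ = x α₁ + y α₂ + α₃ + ⋯ + α_ℓ and let W_ℓ(j) count its decompositions into j positive
-- roots. All roots have nonnegative α-coordinates; those of ξ_ℓ vanish beyond α_ℓ and its
-- α_r-coordinate is at most 1, so only the type A roots ε_i − ε_k with i < k ≤ ℓ + 1 can occur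
-- (reading ε_{r+1} = 0, so that ε_i = ε_i − ε_{r+1}). As the α_ℓ-coordinate of ξ_ℓ is 1, a
-- decomposition uses exactly one root ε_i − ε_{ℓ+1} (i ≤ ℓ), and removing it leaves
-- ξ_{ℓ-1} − (ε_i − ε_ℓ) for i < ℓ and ξ_{ℓ-1} for i = ℓ. Doing this for ξ_{ℓ+1} and then
-- regrouping the terms i < ℓ + 1 by the same splitting of ξ_ℓ gives
-- W_{ℓ+1}(j+1) = W_ℓ(j+1) + W_ℓ(j), a factor 1 + q; for ℓ = 3 the three choices of i leave
-- (x-1) α₁ + (y-1) α₂, x α₁ + (y-1) α₂ and x α₁ + y α₂ with one root fewer, a factor q.

module Submission where

open import Defs
open import Data.Nat using (ℕ; _≤_; _∸_)
open import Data.Fin using (toℕ)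
open import Relation.Binary.PropositionalEquality using (_≡_)

open import Algebra.Bundles using (AbelianGroup)
open import Algebra.Properties.Group using (∙-cancelˡ)
open import Data.Bool using (true; false; if_then_else_)
open import Data.Bool.Properties using (T-≡)
open import Data.Empty using (⊥-elim)
open import Data.Fin as F using (Fin)
open import Data.Integer as Z using (ℤ; +_)
import Data.Integer.Properties as ZP
open import Data.Integer.Solver using (module +-*-Solver)
open import Data.List as L using (List; []; _∷_; _++_)
import Data.List.Properties as LP
open import Data.List.Relation.Binary.Permutation.Propositional as ↭
  using (_↭_; ↭-reflexive; module PermutationReasoning)
import Data.List.Relation.Binary.Permutation.Propositional.Properties as ↭P
open import Data.List.Relation.Unary.All as All using (All; []; _∷_)
import Data.List.Relation.Unary.All.Properties as AllP
open import Data.Nat as N using (zero; suc; _+_; _*_; _<_; z≤n; s≤s; _<ᵇ_; _≡ᵇ_)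
open import Data.Nat.ListAction using (sum)
open import Data.Nat.ListAction.Properties using (sum-++)
import Data.Nat.Properties as NP
open import Algebra.Properties.CommutativeSemigroup NP.+-commutativeSemigroup using (interchange)
open import Data.Product using (Σ; _,_; _×_)
open import Data.Sum using (inj₁; inj₂)
open import Data.Vec as V using ([]; _∷_)
import Data.Vec.Properties as VP
open import Function using (_∘_; _$_; id; flip)
open import Function.Bundles using (Equivalence)
open import Relation.Binary.Definitions using (tri<; tri≈; tri>)
open import Relation.Binary.PropositionalEquality
  using (_≢_; refl; sym; trans; cong; cong₂; subst; subst₂; module ≡-Reasoning)
open import Relation.Nullary.Decidable using (yes; no; ⌊⌋-map′)

open +-*-Solver using (solve; _:+_; _:-_; _:=_)

-- The partial sum v₀ + ⋯ + vₘ is the coefficient of α m in v, because ε i = α i + ⋯ + α (r - 1).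
coord : ∀ {r} → ℕ → Weight r → ℤ
coord m [] = + 0
coord zero (a ∷ v) = a
coord (suc m) (a ∷ v) = a Z.+ coord m v

coord-⊕ : ∀ {r} m (u v : Weight r) → coord m (u ⊕ʷ v) ≡ coord m u Z.+ coord m v
coord-⊕ m [] [] = refl
coord-⊕ zero (a ∷ u) (b ∷ v) = refl
coord-⊕ (suc m) (a ∷ u) (b ∷ v) rewrite coord-⊕ m u v =
  solve 4 (λ a b c d → (a :+ b) :+ (c :+ d) := (a :+ c) :+ (b :+ d)) refl a b (coord m u) (coord m v)

coord-⊖ : ∀ {r} m (u v : Weight r) → coord m (u ⊖ʷ v) ≡ coord m u Z.- coord m v
coord-⊖ m [] [] = refl
coord-⊖ zero (a ∷ u) (b ∷ v) = refl
coord-⊖ (suc m) (a ∷ u) (b ∷ v) rewrite coord-⊖ m u v =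
  solve 4 (λ a b c d → (a :- b) :+ (c :- d) := (a :+ c) :- (b :+ d)) refl a b (coord m u) (coord m v)

coord-scale : ∀ {r} m k (v : Weight r) → coord m (scale k v) ≡ k Z.* coord m v
coord-scale m k [] = sym (ZP.*-zeroʳ k)
coord-scale zero k (a ∷ v) = refl
coord-scale (suc m) k (a ∷ v) rewrite coord-scale m k v = sym (ZP.*-distribˡ-+ k a (coord m v))

coord-𝟘 : ∀ {r} m → coord m (𝟘 {r}) ≡ + 0
coord-𝟘 {zero} m = refl
coord-𝟘 {suc r} zero = refl
coord-𝟘 {suc r} (suc m) = trans (ZP.+-identityˡ _) (coord-𝟘 {r} m)

coord-⊖-scale : ∀ {r} m (ξ β : Weight r) k →
  coord m (ξ ⊖ʷ scale (+ k) β) ≡ coord m ξ Z.- (+ k) Z.* coord m β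
coord-⊖-scale m ξ β k = trans (coord-⊖ m ξ _) (cong (λ t → coord m ξ Z.- t) (coord-scale m (+ k) β))

coord-injective : ∀ {r} (u v : Weight r) → (∀ m → m < r → coord m u ≡ coord m v) → u ≡ v
coord-injective [] [] _ = refl
coord-injective (a ∷ u) (b ∷ v) h = cong₂ _∷_ a≡b (coord-injective u v λ m m<r →
  +-cancelˡ a _ _ (trans (h (suc m) (s≤s m<r)) (cong (Z._+ coord m v) (sym a≡b))))
  where
  a≡b : a ≡ b
  a≡b = h zero (s≤s z≤n)
  +-cancelˡ : ∀ i j k → i Z.+ j ≡ i Z.+ k → j ≡ k
  +-cancelˡ = ∙-cancelˡ (AbelianGroup.group ZP.+-0-abelianGroup)

⊖-scale-0 : ∀ {r} (ξ β : Weight r) → ξ ⊖ʷ scale (+ 0) β ≡ ξ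
⊖-scale-0 [] [] = refl
⊖-scale-0 (a ∷ ξ) (b ∷ β) = cong₂ _∷_ (ZP.+-identityʳ a) (⊖-scale-0 ξ β)

scale-1 : ∀ {r} (β : Weight r) → scale (+ 1) β ≡ β
scale-1 [] = refl
scale-1 (b ∷ β) = cong₂ _∷_ (ZP.*-identityˡ b) (scale-1 β)

⊖-⊖-comm : ∀ {r} (ξ u v : Weight r) → (ξ ⊖ʷ u) ⊖ʷ v ≡ (ξ ⊖ʷ v) ⊖ʷ u
⊖-⊖-comm [] [] [] = refl
⊖-⊖-comm (a ∷ ξ) (b ∷ u) (c ∷ v) =
  cong₂ _∷_ (solve 3 (λ a b c → (a :- b) :- c := (a :- c) :- b) refl a b c) (⊖-⊖-comm ξ u v)

⊖-[⊖-self] : ∀ {r} (ξ u : Weight r) → ξ ⊖ʷ (u ⊖ʷ u) ≡ ξ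
⊖-[⊖-self] [] [] = refl
⊖-[⊖-self] (a ∷ ξ) (b ∷ u) =
  cong₂ _∷_ (solve 2 (λ a b → a :- (b :- b) := a) refl a b) (⊖-[⊖-self] ξ u)

⊕-⊖-telescope : ∀ {r} (w u v t : Weight r) → (w ⊕ʷ (u ⊖ʷ v)) ⊖ʷ (t ⊖ʷ v) ≡ w ⊖ʷ (t ⊖ʷ u)
⊕-⊖-telescope [] [] [] [] = refl
⊕-⊖-telescope (a ∷ w) (b ∷ u) (c ∷ v) (d ∷ t) = cong₂ _∷_
  (solve 4 (λ a b c d → (a :+ (b :- c)) :- (d :- c) := a :- (d :- b)) refl a b c d) (⊕-⊖-telescope w u v t)

⊖-𝟘 : ∀ {r} (v : Weight r) → v ⊖ʷ 𝟘 ≡ v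
⊖-𝟘 [] = refl
⊖-𝟘 (a ∷ v) = cong₂ _∷_ (ZP.+-identityʳ a) (⊖-𝟘 v)

-- εₙ i is ε_i for i < r and 𝟘 for i ≥ r, so that α_i = εₙ i ⊖ʷ εₙ (1 + i) also for i = r - 1.
εₙ : ∀ {r} → ℕ → Weight r
εₙ {zero} _ = []
εₙ {suc r} zero = + 1 ∷ 𝟘
εₙ {suc r} (suc i) = + 0 ∷ εₙ i

εₙ-out-of-range : ∀ {r} → εₙ {r} r ≡ 𝟘
εₙ-out-of-range {zero} = refl
εₙ-out-of-range {suc r} = cong (+ 0 ∷_) (εₙ-out-of-range {r})

tabulate-0 : ∀ {r} → V.tabulate {n = r} (λ _ → + 0) ≡ 𝟘
tabulate-0 {zero} = refl
tabulate-0 {suc r} = cong (+ 0 ∷_) (tabulate-0 {r})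

ε≡εₙ : ∀ {r} (i : Fin r) → ε i ≡ εₙ (toℕ i)
ε≡εₙ F.zero = cong (+ 1 ∷_) tabulate-0
ε≡εₙ {suc r} (F.suc i) = cong (+ 0 ∷_) (trans
  (VP.tabulate-cong λ j → cong (λ b → if b then + 1 else + 0) (⌊⌋-map′ _ _ (i F.≟ j)))
  (ε≡εₙ i))

tabulate-≡ᵇ : ∀ {r} n → V.tabulate {n = r} (λ j → if toℕ j ≡ᵇ n then + 1 else + 0) ≡ εₙ n
tabulate-≡ᵇ {zero} n = refl
tabulate-≡ᵇ {suc r} zero = cong (+ 1 ∷_) tabulate-0
tabulate-≡ᵇ {suc r} (suc n) = cong (+ 0 ∷_) (tabulate-≡ᵇ {r} n)

αₙ : ∀ {r} → ℕ → Weight r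
αₙ i = εₙ i ⊖ʷ εₙ (suc i)

α≡αₙ : ∀ {r} (i : Fin r) → α i ≡ αₙ (toℕ i)
α≡αₙ i = cong₂ _⊖ʷ_ (ε≡εₙ i) (tabulate-≡ᵇ (suc (toℕ i)))

<ᵇ-true : ∀ {m n} → m < n → (m <ᵇ n) ≡ true
<ᵇ-true m<n = Equivalence.to T-≡ (NP.<⇒<ᵇ m<n)

<ᵇ-false : ∀ {m n} → n ≤ m → (m <ᵇ n) ≡ false
<ᵇ-false {m} {zero} _ = refl
<ᵇ-false {suc m} {suc n} (s≤s n≤m) = <ᵇ-false n≤m

[_≤_] : ℕ → ℕ → ℤ
[ i ≤ m ] = if i <ᵇ suc m then + 1 else + 0

coord-εₙ : ∀ {r} m i → m < r → coord m (εₙ {r} i) ≡ [ i ≤ m ]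
coord-εₙ {suc r} m zero _ = coord-ε₀ m
  where
  coord-ε₀ : ∀ m → coord m (+ 1 ∷ 𝟘 {r}) ≡ + 1
  coord-ε₀ zero = refl
  coord-ε₀ (suc m) = cong (Z._+_ (+ 1)) (coord-𝟘 {r} m)
coord-εₙ {suc r} zero (suc i) _ = refl
coord-εₙ {suc r} (suc m) (suc i) (s≤s m<r) = trans (ZP.+-identityˡ _) (coord-εₙ m i m<r)

coord-εₙ-≤ : ∀ {r} m i → i ≤ m → m < r → coord m (εₙ {r} i) ≡ + 1
coord-εₙ-≤ m i i≤m m<r = trans (coord-εₙ m i m<r)
  (cong (λ b → if b then + 1 else + 0) (<ᵇ-true (s≤s i≤m)))

coord-εₙ-> : ∀ {r} m i → m < i → coord m (εₙ {r} i) ≡ + 0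
coord-εₙ-> {zero} m i _ = refl
coord-εₙ-> {suc r} zero (suc i) _ = refl
coord-εₙ-> {suc r} (suc m) (suc i) (s≤s m<i) = trans (ZP.+-identityˡ _) (coord-εₙ-> {r} m i m<i)

combinationₙ : ∀ {r} → (ℕ → ℕ) → List (Fin r) → Weight r
combinationₙ c = L.foldr (λ i acc → scale (+ c (toℕ i)) (αₙ (toℕ i)) ⊕ʷ acc) 𝟘

foldr-α≡combinationₙ : ∀ {r} (c : ℕ → ℕ) (is : List (Fin r)) →
  L.foldr (λ i acc → scale (+ c (toℕ i)) (α i) ⊕ʷ acc) 𝟘 is ≡ combinationₙ c is
foldr-α≡combinationₙ c [] = refl
foldr-α≡combinationₙ c (i ∷ is) =
  cong₂ (λ a b → scale (+ c (toℕ i)) a ⊕ʷ b) (α≡αₙ i) (foldr-α≡combinationₙ c is)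

combinationₙ-map-suc : ∀ {r} (c : ℕ → ℕ) (is : List (Fin r)) →
  combinationₙ c (L.map F.suc is) ≡ + 0 ∷ combinationₙ (c ∘ suc) is
combinationₙ-map-suc c [] = refl
combinationₙ-map-suc c (i ∷ is) rewrite combinationₙ-map-suc c is =
  cong₂ _∷_ (trans (ZP.+-identityʳ _) (ZP.*-zeroʳ (+ c (suc (toℕ i))))) refl

combo-suc : ∀ {r} (c : ℕ → ℕ) → combo {suc r} (c ∘ toℕ)
  ≡ scale (+ c 0) (αₙ {suc r} 0) ⊕ʷ (+ 0 ∷ combo {r} (c ∘ suc ∘ toℕ))
combo-suc {r} c = begin
    combo (c ∘ toℕ)
  ≡⟨ foldr-α≡combinationₙ c (L.allFin (suc r)) ⟩
    scale (+ c 0) (αₙ 0) ⊕ʷ combinationₙ c (L.tabulate F.suc)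
  ≡⟨ cong (λ is → scale (+ c 0) (αₙ 0) ⊕ʷ combinationₙ c is) (sym (LP.map-tabulate id F.suc)) ⟩
    scale (+ c 0) (αₙ 0) ⊕ʷ combinationₙ c (L.map F.suc (L.allFin r))
  ≡⟨ cong (scale (+ c 0) (αₙ 0) ⊕ʷ_) (combinationₙ-map-suc c (L.allFin r)) ⟩
    scale (+ c 0) (αₙ 0) ⊕ʷ (+ 0 ∷ combinationₙ (c ∘ suc) (L.allFin r))
  ≡⟨ cong (λ v → scale (+ c 0) (αₙ 0) ⊕ʷ (+ 0 ∷ v)) (sym (foldr-α≡combinationₙ (c ∘ suc) (L.allFin r))) ⟩
    scale (+ c 0) (αₙ 0) ⊕ʷ (+ 0 ∷ combo (c ∘ suc ∘ toℕ)) ∎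
  where open ≡-Reasoning

coord-combo : ∀ {r} (c : ℕ → ℕ) m → m < r → coord m (combo {r} (c ∘ toℕ)) ≡ + c m
coord-combo {suc r} c m m<r rewrite combo-suc {r} c
  | coord-⊕ m (scale (+ c 0) (αₙ {suc r} 0)) (+ 0 ∷ combo {r} (c ∘ suc ∘ toℕ))
  | coord-scale m (+ c 0) (αₙ {suc r} 0)
  | coord-⊖ m (εₙ {suc r} 0) (εₙ 1) = coordinates m m<r
  where
  coordinates : ∀ m → m < suc r → + c 0 Z.* (coord m (εₙ {suc r} 0) Z.- coord m (εₙ {suc r} 1))
        Z.+ coord m (+ 0 ∷ combo {r} (c ∘ suc ∘ toℕ)) ≡ + c m
  coordinates zero _ rewrite coord-εₙ-> {suc r} 0 1 (s≤s z≤n) = trans (ZP.+-identityʳ _) (ZP.*-identityʳ _)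
  coordinates (suc m) (s≤s m<r) rewrite coord-εₙ-≤ {suc r} (suc m) 0 z≤n (s≤s m<r)
     | coord-εₙ-≤ {suc r} (suc m) 1 (s≤s z≤n) (s≤s m<r)
     | ZP.*-zeroʳ (+ c 0)
     | coord-combo (c ∘ suc) m m<r = refl

sumTo-cong : ∀ n {f g : ℕ → ℕ} → (∀ k → k ≤ n → f k ≡ g k) → sumTo n f ≡ sumTo n g
sumTo-cong zero h = h 0 z≤n
sumTo-cong (suc n) h =
  cong₂ _+_ (sumTo-cong n (λ k k≤n → h k (NP.m≤n⇒m≤1+n k≤n))) (h (suc n) NP.≤-refl)

sumTo-cong′ : ∀ n {f g : ℕ → ℕ} → (∀ k → f k ≡ g k) → sumTo n f ≡ sumTo n g
sumTo-cong′ n h = sumTo-cong n (λ k _ → h k)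

sumTo-zero : ∀ n {f : ℕ → ℕ} → (∀ k → f k ≡ 0) → sumTo n f ≡ 0
sumTo-zero zero h = h 0
sumTo-zero (suc n) h rewrite sumTo-zero n h | h (suc n) = refl

sumTo-unfoldˡ : ∀ n (f : ℕ → ℕ) → sumTo (suc n) f ≡ f 0 + sumTo n (f ∘ suc)
sumTo-unfoldˡ zero f = refl
sumTo-unfoldˡ (suc n) f rewrite sumTo-unfoldˡ n f = NP.+-assoc (f 0) _ _

sumTo-head : ∀ n {f : ℕ → ℕ} → (∀ k → f (suc k) ≡ 0) → sumTo n f ≡ f 0
sumTo-head zero h = refl
sumTo-head (suc n) h rewrite h n = trans (NP.+-identityʳ _) (sumTo-head n h)

sumTo-+ : ∀ n (f g : ℕ → ℕ) → sumTo n (λ k → f k + g k) ≡ sumTo n f + sumTo n g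
sumTo-+ zero f g = refl
sumTo-+ (suc n) f g rewrite sumTo-+ n f g =
  interchange (sumTo n f) (sumTo n g) (f (suc n)) (g (suc n))

sumTo-reverse : ∀ n (f : ℕ → ℕ) → sumTo n f ≡ sumTo n (λ k → f (n ∸ k))
sumTo-reverse zero f = refl
sumTo-reverse (suc n) f = begin
    sumTo (suc n) f
  ≡⟨ sumTo-unfoldˡ n f ⟩
    f 0 + sumTo n (f ∘ suc)
  ≡⟨ cong (_+_ (f 0)) (sumTo-reverse n (f ∘ suc)) ⟩
    f 0 + sumTo n (λ k → f (suc (n ∸ k)))
  ≡⟨ NP.+-comm (f 0) _ ⟩
    sumTo n (λ k → f (suc (n ∸ k))) + f 0
  ≡⟨ cong₂ _+_ (sumTo-cong n (λ k k≤n → cong f (sym (NP.+-∸-assoc 1 k≤n))))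
               (cong f (sym (NP.n∸n≡0 n))) ⟩
    sumTo (suc n) (λ k → f (suc n ∸ k)) ∎
  where open ≡-Reasoning

triangle : ℕ → (ℕ → ℕ → ℕ) → ℕ
triangle j g = sumTo j (λ a → sumTo (j ∸ a) (g a))

antidiagonal : ℕ → (ℕ → ℕ → ℕ) → ℕ
antidiagonal n g = sumTo n (λ a → g a (n ∸ a))

triangle-suc : ∀ j g → triangle (suc j) g ≡ triangle j g + antidiagonal (suc j) g
triangle-suc j g = begin
    sumTo j (λ a → sumTo (suc j ∸ a) (g a)) + sumTo (j ∸ j) (g (suc j))
  ≡⟨ cong₂ _+_ (sumTo-cong j (λ a a≤j → trans (cong (λ t → sumTo t (g a)) (NP.+-∸-assoc 1 a≤j))
                  (cong (λ t → sumTo (j ∸ a) (g a) + g a t) (sym (NP.+-∸-assoc 1 a≤j)))))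
               (cong (λ t → sumTo t (g (suc j))) (NP.n∸n≡0 j)) ⟩
    sumTo j (λ a → sumTo (j ∸ a) (g a) + g a (suc j ∸ a)) + g (suc j) 0
  ≡⟨ cong (_+ g (suc j) 0) (sumTo-+ j _ _) ⟩
    (triangle j g + sumTo j (λ a → g a (suc j ∸ a))) + g (suc j) 0
  ≡⟨ NP.+-assoc (triangle j g) _ _ ⟩
    triangle j g + (sumTo j (λ a → g a (suc j ∸ a)) + g (suc j) 0)
  ≡⟨ cong (λ t → triangle j g + (sumTo j (λ a → g a (suc j ∸ a)) + g (suc j) t)) (sym (NP.n∸n≡0 j)) ⟩
    triangle j g + antidiagonal (suc j) g ∎
  where open ≡-Reasoning

antidiagonal-transpose : ∀ n g → antidiagonal n g ≡ antidiagonal n (flip g)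
antidiagonal-transpose n g = trans (sumTo-reverse n _)
  (sumTo-cong n (λ a a≤n → cong (g (n ∸ a)) (NP.m∸[m∸n]≡n a≤n)))

triangle-transpose : ∀ j g → triangle j g ≡ triangle j (flip g)
triangle-transpose zero g = refl
triangle-transpose (suc j) g rewrite triangle-suc j g | triangle-suc j (flip g) | triangle-transpose j g =
  cong (_+_ (triangle j (flip g))) (antidiagonal-transpose (suc j) g)

NonNeg : ∀ {r} → Weight r → Set
NonNeg {r} β = ∀ m → m < r → Σ ℕ λ n → coord m β ≡ + n

Overshoots : ∀ {r} → Weight r → Weight r → Set
Overshoots {r} ξ d = Σ ℕ λ m → m < r × coord m ξ Z.< coord m d

i-k*n≤i : ∀ i n k → i Z.- (+ k) Z.* (+ n) Z.≤ i
i-k*n≤i i n k = subst (λ t → i Z.- t Z.≤ i) (ZP.pos-* k n) (ZP.i-j≤i i (+ (k * n)))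

i-[1+k]*n<0 : ∀ i n k → i Z.< + n → i Z.- (+ suc k) Z.* (+ n) Z.< + 0
i-[1+k]*n<0 i n k i<n = ZP.≤-<-trans i-[1+k]*n≤i-n i-n<0
  where
  i-[1+k]*n≤i-n : i Z.- (+ suc k) Z.* (+ n) Z.≤ i Z.- + n
  i-[1+k]*n≤i-n = subst (Z._≤ i Z.- + n) i-n-kn≡i-[1+k]*n (ZP.i-j≤i (i Z.- + n) (+ (k * n)))
    where
    i-n-kn≡i-[1+k]*n : i Z.- + n Z.- + (k * n) ≡ i Z.- (+ suc k) Z.* (+ n)
    i-n-kn≡i-[1+k]*n = trans
      (solve 3 (λ a b c → (a :- b) :- c := a :- (b :+ c)) refl i (+ n) (+ (k * n)))
      (cong (λ t → i Z.- t) (trans (sym (ZP.pos-+ n (k * n))) (ZP.pos-* (suc k) n)))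
  i-n<0 : i Z.- + n Z.< + 0
  i-n<0 = subst (i Z.- + n Z.<_) (ZP.+-inverseʳ (+ n)) (ZP.+-monoˡ-< (Z.- (+ n)) i<n)

ways-negative : ∀ {r} (L : List (Weight r)) j ξ m → All NonNeg L → m < r →
  coord m ξ Z.< + 0 → ways L j ξ ≡ 0
ways-negative {r} [] zero ξ m _ m<r ξₘ<0 with VP.≡-dec Z._≟_ ξ 𝟘
... | yes refl = ⊥-elim (ZP.<-irrefl (coord-𝟘 {r} m) ξₘ<0)
... | no _ = refl
ways-negative [] (suc j) ξ m _ m<r ξₘ<0 = refl
ways-negative (β ∷ L) j ξ m (β≥0 ∷ L≥0) m<r ξₘ<0 =
  sumTo-zero j (λ k → ways-negative L (j ∸ k) _ m L≥0 m<r (still-negative k))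
  where
  still-negative : ∀ k → coord m (ξ ⊖ʷ scale (+ k) β) Z.< + 0
  still-negative k with β≥0 m m<r
  ... | n , βₘ≡n rewrite coord-⊖-scale m ξ β k | βₘ≡n = ZP.≤-<-trans (i-k*n≤i _ n k) ξₘ<0

ways-coord-≢0 : ∀ {r} (L : List (Weight r)) j ξ m → All (λ β → coord m β ≡ + 0) L →
  coord m ξ ≢ + 0 → ways L j ξ ≡ 0
ways-coord-≢0 {r} [] zero ξ m _ ξₘ≢0 with VP.≡-dec Z._≟_ ξ 𝟘
... | yes refl = ⊥-elim (ξₘ≢0 (coord-𝟘 {r} m))
... | no _ = refl
ways-coord-≢0 [] (suc j) ξ m _ _ = refl
ways-coord-≢0 (β ∷ L) j ξ m (βₘ≡0 ∷ L≡0) ξₘ≢0 =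
  sumTo-zero j (λ k → ways-coord-≢0 L (j ∸ k) _ m L≡0 (still-≢0 k))
  where
  still-≢0 : ∀ k → coord m (ξ ⊖ʷ scale (+ k) β) ≢ + 0
  still-≢0 k rewrite coord-⊖-scale m ξ β k | βₘ≡0 | ZP.*-zeroʳ (+ k) | ZP.+-identityʳ (coord m ξ) =
    ξₘ≢0

ways-zero : ∀ {r} (L : List (Weight r)) ξ → ways L 0 ξ ≡ ways [] 0 ξ
ways-zero [] ξ = refl
ways-zero (β ∷ L) ξ rewrite ⊖-scale-0 ξ β = ways-zero L ξ

ways-drop-overshooting : ∀ {r} (Ds Ls : List (Weight r)) j ξ → All NonNeg (Ds ++ Ls) →
  All (Overshoots ξ) Ds → ways (Ds ++ Ls) j ξ ≡ ways Ls j ξ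
ways-drop-overshooting [] Ls j ξ _ _ = refl
ways-drop-overshooting (d ∷ Ds) Ls j ξ (d≥0 ∷ ≥0) ((m , m<r , ξₘ<dₘ) ∷ over) = begin
    sumTo j (λ k → ways (Ds ++ Ls) (j ∸ k) (ξ ⊖ʷ scale (+ k) d))
  ≡⟨ sumTo-head j unused ⟩
    ways (Ds ++ Ls) j (ξ ⊖ʷ scale (+ 0) d)
  ≡⟨ cong (ways (Ds ++ Ls) j) (⊖-scale-0 ξ d) ⟩
    ways (Ds ++ Ls) j ξ
  ≡⟨ ways-drop-overshooting Ds Ls j ξ ≥0 over ⟩
    ways Ls j ξ ∎
  where
  open ≡-Reasoning
  unused : ∀ k → ways (Ds ++ Ls) (j ∸ suc k) (ξ ⊖ʷ scale (+ suc k) d) ≡ 0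
  unused k with d≥0 m m<r
  ... | n , dₘ≡n = ways-negative (Ds ++ Ls) _ _ m ≥0 m<r negative
    where
    negative : coord m (ξ ⊖ʷ scale (+ suc k) d) Z.< + 0
    negative rewrite coord-⊖-scale m ξ d (suc k) | dₘ≡n = i-[1+k]*n<0 (coord m ξ) n k ξₘ<dₘ

ways-unit-coord : ∀ {r} (Bs Ls : List (Weight r)) j ξ m → m < r → All NonNeg (Bs ++ Ls) →
  All (λ b → coord m b ≡ + 1) Bs → All (λ β → coord m β ≡ + 0) Ls → coord m ξ ≡ + 1 →
  ways (Bs ++ Ls) (suc j) ξ ≡ sum (L.map (λ b → ways Ls j (ξ ⊖ʷ b)) Bs)
ways-unit-coord [] Ls j ξ m m<r _ _ Lₘ≡0 ξₘ≡1 =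
  ways-coord-≢0 Ls (suc j) ξ m Lₘ≡0 (λ ξₘ≡0 → 1≢0 (trans (sym ξₘ≡1) ξₘ≡0))
  where
  1≢0 : + 1 ≢ + 0
  1≢0 ()
ways-unit-coord (b ∷ Bs) Ls j ξ m m<r (b≥0 ∷ ≥0) (bₘ≡1 ∷ Bsₘ≡1) Lₘ≡0 ξₘ≡1 = begin
    sumTo (suc j) uses
  ≡⟨ sumTo-unfoldˡ j uses ⟩
    uses 0 + sumTo j (uses ∘ suc)
  ≡⟨ cong₂ _+_ uses-0 (trans (sumTo-head j uses-≥2) uses-1) ⟩
    sum (L.map rest Bs) + rest b
  ≡⟨ NP.+-comm _ (rest b) ⟩
    rest b + sum (L.map rest Bs) ∎
  where
  open ≡-Reasoning
  rest : Weight _ → ℕ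
  rest b′ = ways Ls j (ξ ⊖ʷ b′)
  uses : ℕ → ℕ
  uses k = ways (Bs ++ Ls) (suc j ∸ k) (ξ ⊖ʷ scale (+ k) b)
  uses-0 : uses 0 ≡ sum (L.map rest Bs)
  uses-0 rewrite ⊖-scale-0 ξ b = ways-unit-coord Bs Ls j ξ m m<r ≥0 Bsₘ≡1 Lₘ≡0 ξₘ≡1
  uses-≥2 : ∀ k → uses (suc (suc k)) ≡ 0
  uses-≥2 k = ways-negative (Bs ++ Ls) _ _ m ≥0 m<r negative
    where
    negative : coord m (ξ ⊖ʷ scale (+ suc (suc k)) b) Z.< + 0
    negative rewrite coord-⊖-scale m ξ b (suc (suc k)) | bₘ≡1 | ξₘ≡1 =
      i-[1+k]*n<0 (+ 0) 1 k (Z.+<+ (s≤s z≤n))    -- 1 - (2 + k) and 0 - (1 + k) compute to the same integer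
  uses-1 : uses 1 ≡ rest b
  uses-1 rewrite scale-1 b =
    ways-drop-overshooting Bs Ls j (ξ ⊖ʷ b) ≥0 (All.map (λ {b′} → overshoots {b′}) Bsₘ≡1)
    where
    overshoots : ∀ {b′} → coord m b′ ≡ + 1 → Overshoots (ξ ⊖ʷ b) b′
    overshoots b′ₘ≡1 = m , m<r ,
      subst₂ Z._<_ (sym (trans (coord-⊖ m ξ b) (cong₂ Z._-_ ξₘ≡1 bₘ≡1))) (sym b′ₘ≡1) (Z.+<+ (s≤s z≤n))

ways-swap : ∀ {r} (β γ : Weight r) Ls j ξ → ways (β ∷ γ ∷ Ls) j ξ ≡ ways (γ ∷ β ∷ Ls) j ξ
ways-swap β γ Ls j ξ = trans (triangle-transpose j _) (sumTo-cong′ j (λ a → sumTo-cong′ (j ∸ a) (λ b →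
  cong₂ (ways Ls)
    (trans (NP.∸-+-assoc j b a) (trans (cong (j ∸_) (NP.+-comm b a)) (sym (NP.∸-+-assoc j a b))))
    (⊖-⊖-comm ξ (scale (+ b) β) (scale (+ a) γ)))))

ways-↭ : ∀ {r} {Ls Ls′ : List (Weight r)} → Ls ↭ Ls′ → ∀ j ξ → ways Ls j ξ ≡ ways Ls′ j ξ
ways-↭ ↭.refl j ξ = refl
ways-↭ (↭.prep x p) j ξ = sumTo-cong′ j (λ k → ways-↭ p (j ∸ k) _)
ways-↭ {Ls = x ∷ y ∷ xs} (↭.swap x y p) j ξ = trans (ways-swap x y xs j ξ)
  (sumTo-cong′ j (λ k → sumTo-cong′ (j ∸ k) (λ k′ → ways-↭ p _ _)))
ways-↭ (↭.trans p q) j ξ = trans (ways-↭ p j ξ) (ways-↭ q j ξ)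

rootA : ∀ {r} → ℕ → ℕ → Weight r
rootA i k = εₙ i ⊖ʷ εₙ k

column : ∀ {r} → ℕ → List (Weight r)
column k = L.map (λ i → rootA i k) (L.upTo k)

rootsA : ∀ {r} → ℕ → List (Weight r)
rootsA zero = []
rootsA (suc k) = column (suc k) ++ rootsA k

All-upTo : ∀ {P : ℕ → Set} n → (∀ {i} → i < n → P i) → All P (L.upTo n)
All-upTo n = AllP.applyUpTo⁺₁ id n

All-column : ∀ {r} {P : Weight r → Set} k → (∀ {i} → i < k → P (rootA i k)) → All P (column {r} k)
All-column k h = AllP.map⁺ (All-upTo k h)

All-rootsA : ∀ {r} {P : Weight r → Set} k → (∀ {i k′} → i < k′ → k′ ≤ k → P (rootA i k′)) →
  All P (rootsA {r} k)
All-rootsA zero h = []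
All-rootsA (suc k) h = AllP.++⁺ (All-column (suc k) (λ i<k → h i<k NP.≤-refl))
  (All-rootsA k (λ i<k′ k′≤k → h i<k′ (NP.m≤n⇒m≤1+n k′≤k)))

coord-rootA-< : ∀ {r} m i k → m < i → i < k → coord m (rootA {r} i k) ≡ + 0
coord-rootA-< {r} m i k m<i i<k = trans (coord-⊖ m (εₙ {r} i) (εₙ k))
  (cong₂ Z._-_ (coord-εₙ-> {r} m i m<i) (coord-εₙ-> {r} m k (NP.<-trans m<i i<k)))

coord-rootA-∈ : ∀ {r} m i k → i ≤ m → m < k → m < r → coord m (rootA {r} i k) ≡ + 1
coord-rootA-∈ {r} m i k i≤m m<k m<r = trans (coord-⊖ m (εₙ {r} i) (εₙ k))
  (cong₂ Z._-_ (coord-εₙ-≤ {r} m i i≤m m<r) (coord-εₙ-> {r} m k m<k))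

coord-rootA-≥ : ∀ {r} m i k → k ≤ m → i < k → m < r → coord m (rootA {r} i k) ≡ + 0
coord-rootA-≥ {r} m i k k≤m i<k m<r = trans (coord-⊖ m (εₙ {r} i) (εₙ k))
  (cong₂ Z._-_ (coord-εₙ-≤ {r} m i (NP.≤-trans (NP.<⇒≤ i<k) k≤m) m<r) (coord-εₙ-≤ {r} m k k≤m m<r))

coord-column-top : ∀ {r} k → k < r → All (λ β → coord k β ≡ + 1) (column {r} (suc k))
coord-column-top {r} k k<r =
  All-column (suc k) (λ {i} i≤k → coord-rootA-∈ {r} k i (suc k) (NP.≤-pred i≤k) NP.≤-refl k<r)

nonNeg-rootA : ∀ {r} {i k} → i < k → NonNeg (rootA {r} i k)
nonNeg-rootA {r} {i} {k} i<k m m<r with m N.<? i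
... | yes m<i = 0 , coord-rootA-< {r} m i k m<i i<k
... | no m≮i with m N.<? k
...   | yes m<k = 1 , coord-rootA-∈ m i k (NP.≮⇒≥ m≮i) m<k m<r
...   | no m≮k = 0 , coord-rootA-≥ m i k (NP.≮⇒≥ m≮k) i<k m<r

nonNeg-column : ∀ {r} k → All NonNeg (column {r} k)
nonNeg-column k = All-column k nonNeg-rootA

nonNeg-rootsA : ∀ {r} k → All NonNeg (rootsA {r} k)
nonNeg-rootsA k = All-rootsA k (λ i<k′ _ → nonNeg-rootA i<k′)

ways-rootsA-suc : ∀ {r} k j (ξ : Weight r) → k < r → coord k ξ ≡ + 1 →
  ways (rootsA (suc k)) (suc j) ξ
  ≡ sum (L.map (λ i → ways (rootsA k) j (ξ ⊖ʷ rootA i (suc k))) (L.upTo (suc k)))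
ways-rootsA-suc {r} k j ξ k<r ξₖ≡1 = trans
  (ways-unit-coord (column (suc k)) (rootsA k) j ξ k k<r (nonNeg-rootsA (suc k)) (coord-column-top k k<r)
     (All-rootsA k (λ {i} {k′} i<k′ k′≤k → coord-rootA-≥ {r} k i k′ k′≤k i<k′ k<r)) ξₖ≡1)
  (cong sum (sym (LP.map-∘ (L.upTo (suc k)))))

overPairs : ∀ {X : Set} → (ℕ → ℕ → List X) → ℕ → List X
overPairs g N = L.concatMap (λ i → L.concatMap (g i) (L.upTo N)) (L.upTo N)

minusRoot plusRoot pairRoots : ∀ {r} → ℕ → ℕ → List (Weight r)
minusRoot i j = if i <ᵇ j then rootA i j ∷ [] else []
plusRoot i j = if i <ᵇ j then (εₙ i ⊕ʷ εₙ j) ∷ [] else []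
pairRoots i j = if i <ᵇ j then (εₙ i ⊖ʷ εₙ j) ∷ (εₙ i ⊕ʷ εₙ j) ∷ [] else []

pairRoots-split : ∀ {r} i j → pairRoots {r} i j ≡ minusRoot i j ++ plusRoot i j
pairRoots-split i j with i <ᵇ j
... | true = refl
... | false = refl

map-toℕ-allFin : ∀ n → L.map toℕ (L.allFin n) ≡ L.upTo n
map-toℕ-allFin n = trans (LP.map-tabulate id toℕ) (tabulate-toℕ n)
  where
  tabulate-toℕ : ∀ n → L.tabulate {n = n} toℕ ≡ L.upTo n
  tabulate-toℕ zero = refl
  tabulate-toℕ (suc n) = cong (0 ∷_) (begin
      L.tabulate (suc ∘ toℕ)      ≡⟨ LP.map-tabulate toℕ suc ⟨
      L.map suc (L.tabulate toℕ)  ≡⟨ cong (L.map suc) (tabulate-toℕ n) ⟩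
      L.map suc (L.upTo n)        ≡⟨ LP.map-upTo suc n ⟩
      L.applyUpTo suc n           ∎)
    where open ≡-Reasoning

concatMap-allFin : ∀ {X : Set} {r} (f : Fin r → List X) (g : ℕ → List X) → (∀ i → f i ≡ g (toℕ i)) →
  L.concatMap f (L.allFin r) ≡ L.concatMap g (L.upTo r)
concatMap-allFin {r = r} f g f≡g = begin
  L.concatMap f (L.allFin r)                ≡⟨ LP.concatMap-cong f≡g (L.allFin r) ⟩
  L.concatMap (g ∘ toℕ) (L.allFin r)        ≡⟨ LP.concatMap-map g toℕ (L.allFin r) ⟨
  L.concatMap g (L.map toℕ (L.allFin r))    ≡⟨ cong (L.concatMap g) (map-toℕ-allFin r) ⟩
  L.concatMap g (L.upTo r)                  ∎
  where open ≡-Reasoning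

concatMap-++-↭ : ∀ {X Y : Set} (f g : X → List Y) xs →
  L.concatMap (λ x → f x ++ g x) xs ↭ L.concatMap f xs ++ L.concatMap g xs
concatMap-++-↭ f g [] = ↭.refl
concatMap-++-↭ f g (x ∷ xs) = begin
  (f x ++ g x) ++ L.concatMap (λ x → f x ++ g x) xs      ≡⟨ LP.++-assoc (f x) (g x) _ ⟩
  f x ++ g x ++ L.concatMap (λ x → f x ++ g x) xs        ↭⟨ ↭P.++⁺ˡ (f x) (↭P.++⁺ˡ (g x) (concatMap-++-↭ f g xs)) ⟩
  f x ++ g x ++ L.concatMap f xs ++ L.concatMap g xs     ↭⟨ ↭P.++⁺ˡ (f x) (↭P.shifts (g x) (L.concatMap f xs)) ⟩
  f x ++ L.concatMap f xs ++ g x ++ L.concatMap g xs     ≡⟨ LP.++-assoc (f x) (L.concatMap f xs) _ ⟨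
  (f x ++ L.concatMap f xs) ++ g x ++ L.concatMap g xs   ∎
  where open PermutationReasoning

concatMap-↭ : ∀ {X Y : Set} (f g : X → List Y) xs → (∀ x → f x ↭ g x) →
  L.concatMap f xs ↭ L.concatMap g xs
concatMap-↭ f g [] _ = ↭.refl
concatMap-↭ f g (x ∷ xs) f↭g = ↭P.++⁺ (f↭g x) (concatMap-↭ f g xs f↭g)

posRoots≡ : ∀ r → posRoots r ≡ overPairs {Weight r} pairRoots r ++ L.map εₙ (L.upTo r)
posRoots≡ r = cong₂ _++_
  (concatMap-allFin _ _ (λ i → concatMap-allFin _ _ (λ j →
    cong₂ (λ a b → if toℕ i <ᵇ toℕ j then (a ⊖ʷ b) ∷ (a ⊕ʷ b) ∷ [] else []) (ε≡εₙ i) (ε≡εₙ j))))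
  (begin
    L.map ε (L.allFin r)           ≡⟨ LP.map-cong ε≡εₙ (L.allFin r) ⟩
    L.map (εₙ ∘ toℕ) (L.allFin r)  ≡⟨ LP.map-∘ (L.allFin r) ⟩
    L.map εₙ (L.map toℕ (L.allFin r)) ≡⟨ cong (L.map εₙ) (map-toℕ-allFin r) ⟩
    L.map εₙ (L.upTo r)            ∎)
  where open ≡-Reasoning

overPairs-pairRoots-↭ : ∀ {r} N →
  overPairs {Weight r} pairRoots N ↭ overPairs minusRoot N ++ overPairs plusRoot N
overPairs-pairRoots-↭ N = ↭.trans
  (concatMap-↭ _ _ (L.upTo N) (λ i → ↭.trans
    (↭-reflexive (LP.concatMap-cong (pairRoots-split i) (L.upTo N)))
    (concatMap-++-↭ (minusRoot i) (plusRoot i) (L.upTo N))))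
  (concatMap-++-↭ _ _ (L.upTo N))

concatMap-minusRoot-below : ∀ {r} N is → All (_≤ N) is → L.concatMap (minusRoot {r} N) is ≡ []
concatMap-minusRoot-below N [] [] = refl
concatMap-minusRoot-below N (i ∷ is) (i≤N ∷ is≤N) rewrite <ᵇ-false {N} {i} i≤N =
  concatMap-minusRoot-below N is is≤N

concatMap-minusRoot-above : ∀ {r} N is → All (_< N) is →
  L.concatMap (λ i → minusRoot {r} i N ++ []) is ≡ L.map (λ i → rootA i N) is
concatMap-minusRoot-above N [] [] = refl
concatMap-minusRoot-above N (i ∷ is) (i<N ∷ is<N) rewrite <ᵇ-true i<N =
  cong (rootA i N ∷_) (concatMap-minusRoot-above N is is<N)

overPairs-minusRoot-↭ : ∀ {r} n → overPairs (minusRoot {r}) (suc n) ↭ rootsA n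
overPairs-minusRoot-↭ zero = ↭.refl
overPairs-minusRoot-↭ {r} (suc n) = begin
  L.concatMap (λ i → L.concatMap (minusRoot i) (L.upTo (suc N))) (L.upTo (suc N))
    ≡⟨ cong (λ is → L.concatMap (λ i → L.concatMap (minusRoot i) is) is) (sym (LP.upTo-∷ʳ N)) ⟩
  L.concatMap (λ i → L.concatMap (minusRoot i) (U ++ N ∷ [])) (U ++ N ∷ [])
    ≡⟨ LP.concatMap-cong (λ i → LP.concatMap-++ (minusRoot i) U (N ∷ [])) (U ++ N ∷ []) ⟩
  L.concatMap rowWithLast (U ++ N ∷ [])
    ≡⟨ LP.concatMap-++ rowWithLast U (N ∷ []) ⟩
  L.concatMap rowWithLast U ++ L.concatMap rowWithLast (N ∷ [])
    ≡⟨ cong (L.concatMap rowWithLast U ++_) lastRow-empty ⟩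
  L.concatMap rowWithLast U ++ []
    ≡⟨ LP.++-identityʳ _ ⟩
  L.concatMap rowWithLast U
    ↭⟨ concatMap-++-↭ (λ i → L.concatMap (minusRoot i) U) (λ i → minusRoot i N ++ []) U ⟩
  overPairs minusRoot N ++ L.concatMap (λ i → minusRoot i N ++ []) U
    ↭⟨ ↭P.++⁺ (overPairs-minusRoot-↭ n) (↭-reflexive (concatMap-minusRoot-above N U (AllP.all-upTo N))) ⟩
  rootsA n ++ column N
    ↭⟨ ↭P.++-comm (rootsA n) (column N) ⟩
  column N ++ rootsA n ∎
  where
  open PermutationReasoning
  N : ℕ
  N = suc n
  U : List ℕ
  U = L.upTo N
  rowWithLast : ℕ → List (Weight r)
  rowWithLast i = L.concatMap (minusRoot i) U ++ (minusRoot i N ++ [])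
  lastRow-empty : L.concatMap rowWithLast (N ∷ []) ≡ []
  lastRow-empty rewrite concatMap-minusRoot-below {r} N U (All.map NP.<⇒≤ (AllP.all-upTo N))
    | <ᵇ-false {N} {N} NP.≤-refl = refl

posRoots-↭ : ∀ r → posRoots (suc r) ↭ rootsA (suc r) ++ overPairs plusRoot (suc r)
posRoots-↭ r′ = begin
  posRoots r
    ≡⟨ posRoots≡ r ⟩
  overPairs pairRoots r ++ shortRoots
    ↭⟨ ↭P.++⁺ʳ shortRoots (overPairs-pairRoots-↭ r) ⟩
  (overPairs minusRoot r ++ overPairs plusRoot r) ++ shortRoots
    ↭⟨ ↭P.++-assoc (overPairs minusRoot r) (overPairs plusRoot r) shortRoots ⟩
  overPairs minusRoot r ++ overPairs plusRoot r ++ shortRoots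
    ↭⟨ ↭P.++⁺ˡ (overPairs minusRoot r) (↭P.++-comm (overPairs plusRoot r) shortRoots) ⟩
  overPairs minusRoot r ++ shortRoots ++ overPairs plusRoot r
    ↭⟨ ↭P.++-assoc (overPairs minusRoot r) shortRoots (overPairs plusRoot r) ⟨
  (overPairs minusRoot r ++ shortRoots) ++ overPairs plusRoot r
    ↭⟨ ↭P.++⁺ʳ (overPairs plusRoot r) (↭P.++⁺ (overPairs-minusRoot-↭ r′) (↭-reflexive shortRoots≡column)) ⟩
  (rootsA r′ ++ column r) ++ overPairs plusRoot r
    ↭⟨ ↭P.++⁺ʳ (overPairs plusRoot r) (↭P.++-comm (rootsA r′) (column r)) ⟩
  rootsA r ++ overPairs plusRoot r ∎
  where
  open PermutationReasoning
  r : ℕ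
  r = suc r′
  shortRoots : List (Weight r)
  shortRoots = L.map εₙ (L.upTo r)
  shortRoots≡column : shortRoots ≡ column r
  shortRoots≡column =
    LP.map-cong (λ i → sym (trans (cong (εₙ i ⊖ʷ_) (εₙ-out-of-range {r})) (⊖-𝟘 (εₙ i)))) (L.upTo r)

nonNeg-εₙ : ∀ {r} i → NonNeg (εₙ {r} i)
nonNeg-εₙ {r} i m m<r with i N.≤? m
... | yes i≤m = 1 , coord-εₙ-≤ {r} m i i≤m m<r
... | no i≰m = 0 , coord-εₙ-> {r} m i (NP.≰⇒> i≰m)

nonNeg-⊕ : ∀ {r} (u v : Weight r) → NonNeg u → NonNeg v → NonNeg (u ⊕ʷ v)
nonNeg-⊕ u v u≥0 v≥0 m m<r with u≥0 m m<r | v≥0 m m<r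
... | a , uₘ≡a | b , vₘ≡b = a + b , trans (coord-⊕ m u v) (cong₂ Z._+_ uₘ≡a vₘ≡b)

All-concatMap : ∀ {X Y : Set} {P : Y → Set} {Q : X → Set} (f : X → List Y) xs →
  All Q xs → (∀ x → Q x → All P (f x)) → All P (L.concatMap f xs)
All-concatMap f [] [] _ = []
All-concatMap f (x ∷ xs) (qx ∷ qxs) h = AllP.++⁺ (h x qx) (All-concatMap f xs qxs h)

All-plusRoots : ∀ {r} {P : Weight r → Set} → (∀ i j → i < r → j < r → P (εₙ i ⊕ʷ εₙ j)) →
  All P (overPairs plusRoot r)
All-plusRoots {r} {P} h =
  All-concatMap _ (L.upTo r) (AllP.all-upTo r) λ i i<r →
  All-concatMap _ (L.upTo r) (AllP.all-upTo r) λ j j<r → All-plusRoot i j i<r j<r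
  where
  All-plusRoot : ∀ i j → i < r → j < r → All P (plusRoot {r} i j)
  All-plusRoot i j i<r j<r with i <ᵇ j
  ... | true = h i j i<r j<r ∷ []
  ... | false = []

ways-drop-column : ∀ {r} k (Ps : List (Weight r)) (ξ : Weight r) j → k < r → All NonNeg Ps →
  coord k ξ Z.≤ + 0 → ways (rootsA (suc k) ++ Ps) j ξ ≡ ways (rootsA k ++ Ps) j ξ
ways-drop-column {r} k Ps ξ j k<r Ps≥0 ξₖ≤0 = trans
  (cong (λ L → ways L j ξ) (LP.++-assoc (column (suc k)) (rootsA k) Ps))
  (ways-drop-overshooting (column (suc k)) (rootsA k ++ Ps) j ξ
    (AllP.++⁺ (nonNeg-column (suc k)) (AllP.++⁺ (nonNeg-rootsA k) Ps≥0))
    (All.map (λ βₖ≡1 → k , k<r , ZP.≤-<-trans ξₖ≤0 (subst (+ 0 Z.<_) (sym βₖ≡1) (Z.+<+ (s≤s z≤n))))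
      (coord-column-top k k<r)))

ways-drop-columns : ∀ {r} k n (Ps : List (Weight r)) (ξ : Weight r) j → k ≤ n → n ≤ r → All NonNeg Ps →
  (∀ m → k ≤ m → m < r → coord m ξ Z.≤ + 0) → ways (rootsA n ++ Ps) j ξ ≡ ways (rootsA k ++ Ps) j ξ
ways-drop-columns .zero zero Ps ξ j z≤n _ _ _ = refl
ways-drop-columns k (suc n) Ps ξ j k≤n n<r Ps≥0 ξ≤0 with NP.m≤n⇒m<n∨m≡n k≤n
... | inj₂ refl = refl
... | inj₁ (s≤s k≤n) = trans (ways-drop-column n Ps ξ j n<r Ps≥0 (ξ≤0 n k≤n n<r))
  (ways-drop-columns k n Ps ξ j k≤n (NP.<⇒≤ n<r) Ps≥0 ξ≤0)

ways-posRoots-rootsA : ∀ {r} k (ξ : Weight (suc r)) j → k ≤ suc r →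
  (∀ m → k ≤ m → m < suc r → coord m ξ Z.≤ + 0) → coord r ξ Z.≤ + 1 →
  ways (posRoots (suc r)) j ξ ≡ ways (rootsA k) j ξ
ways-posRoots-rootsA {r} k ξ j k≤r ξ≤0 ξᵣ≤1 = begin
    ways (posRoots (suc r)) j ξ
  ≡⟨ ways-↭ (posRoots-↭ r) j ξ ⟩
    ways (rootsA (suc r) ++ plusRoots) j ξ
  ≡⟨ ways-drop-columns k (suc r) plusRoots ξ j k≤r NP.≤-refl plusRoots≥0 ξ≤0 ⟩
    ways (rootsA k ++ plusRoots) j ξ
  ≡⟨ ways-↭ (↭P.++-comm (rootsA k) plusRoots) j ξ ⟩
    ways (plusRoots ++ rootsA k) j ξ
  ≡⟨ ways-drop-overshooting plusRoots (rootsA k) j ξ (AllP.++⁺ plusRoots≥0 (nonNeg-rootsA k))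
       (All-plusRoots overshoots) ⟩
    ways (rootsA k) j ξ ∎
  where
  open ≡-Reasoning
  plusRoots : List (Weight (suc r))
  plusRoots = overPairs plusRoot (suc r)
  plusRoots≥0 : All NonNeg plusRoots
  plusRoots≥0 = All-plusRoots (λ i j _ _ → nonNeg-⊕ (εₙ i) (εₙ j) (nonNeg-εₙ i) (nonNeg-εₙ j))
  overshoots : ∀ i j → i < suc r → j < suc r → Overshoots ξ (εₙ i ⊕ʷ εₙ j)
  overshoots i j i≤r j≤r = r , NP.≤-refl , ZP.≤-<-trans ξᵣ≤1
    (subst (+ 1 Z.<_)
      (sym (trans (coord-⊕ r (εₙ {suc r} i) (εₙ j))
        (cong₂ Z._+_ (coord-εₙ-≤ {suc r} r i (NP.≤-pred i≤r) NP.≤-refl)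
                     (coord-εₙ-≤ {suc r} r j (NP.≤-pred j≤r) NP.≤-refl))))
      (Z.+<+ (s≤s (s≤s z≤n))))

shift : Poly → Poly
shift P zero = 0
shift P (suc n) = P n

⊛-congˡ : ∀ {P P′ : Poly} (S : Poly) → (∀ n → P n ≡ P′ n) → ∀ n → (P ⊛ S) n ≡ (P′ ⊛ S) n
⊛-congˡ S P≗P′ n = sumTo-cong′ n (λ i → cong (_* S (n ∸ i)) (P≗P′ i))

𝟙⊛ : ∀ P n → (𝟙 ⊛ P) n ≡ P n
𝟙⊛ P zero = NP.+-identityʳ (P 0)
𝟙⊛ P (suc n) = begin
  (𝟙 ⊛ P) (suc n)                      ≡⟨ sumTo-unfoldˡ n _ ⟩
  (P (suc n) + 0) + sumTo n (λ k → 0)  ≡⟨ cong (_+_ (P (suc n) + 0)) (sumTo-zero n (λ _ → refl)) ⟩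
  (P (suc n) + 0) + 0                  ≡⟨ NP.+-identityʳ _ ⟩
  P (suc n) + 0                        ≡⟨ NP.+-identityʳ _ ⟩
  P (suc n)                            ∎
  where open ≡-Reasoning

q⊛ : ∀ P n → (q ⊛ P) n ≡ shift P n
q⊛ P zero = refl
q⊛ P (suc n) = trans (sumTo-unfoldˡ n _) $
  trans (sumTo-cong′ n (λ k → cong (_* P (n ∸ k)) (q-suc k))) (𝟙⊛ P n)
  where
  q-suc : ∀ k → q (suc k) ≡ 𝟙 k
  q-suc zero = refl
  q-suc (suc k) = refl

⊕-⊛ : ∀ P P′ S n → ((P ⊕ P′) ⊛ S) n ≡ (P ⊛ S) n + (P′ ⊛ S) n
⊕-⊛ P P′ S n = trans (sumTo-cong′ n (λ i → NP.*-distribʳ-+ (S (n ∸ i)) (P i) (P′ i))) (sumTo-+ n _ _)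

shift-⊛ : ∀ P S n → (shift P ⊛ S) n ≡ shift (P ⊛ S) n
shift-⊛ P S zero = refl
shift-⊛ P S (suc n) = sumTo-unfoldˡ n _

q[1+q]^⊛ : ℕ → Poly → Poly
q[1+q]^⊛ n S = (q ⊛ ((𝟙 ⊕ q) ^ᵖ n)) ⊛ S

q[1+q]^⊛-shift : ∀ n S m → q[1+q]^⊛ n S m ≡ shift (((𝟙 ⊕ q) ^ᵖ n) ⊛ S) m
q[1+q]^⊛-shift n S m = trans (⊛-congˡ S (q⊛ ((𝟙 ⊕ q) ^ᵖ n)) m) (shift-⊛ ((𝟙 ⊕ q) ^ᵖ n) S m)

q[1+q]^⊛-zero : ∀ n S → q[1+q]^⊛ n S 0 ≡ 0
q[1+q]^⊛-zero n S = q[1+q]^⊛-shift n S 0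

q[1+q]^0⊛-suc : ∀ S j → q[1+q]^⊛ 0 S (suc j) ≡ S j
q[1+q]^0⊛-suc S j = trans (q[1+q]^⊛-shift 0 S (suc j)) (𝟙⊛ S j)

q[1+q]^suc⊛-suc : ∀ n S j → q[1+q]^⊛ (suc n) S (suc j) ≡ q[1+q]^⊛ n S (suc j) + q[1+q]^⊛ n S j
q[1+q]^suc⊛-suc n S j = begin
    q[1+q]^⊛ (suc n) S (suc j)
  ≡⟨ q[1+q]^⊛-shift (suc n) S (suc j) ⟩
    (((𝟙 ⊕ q) ⊛ E) ⊛ S) j
  ≡⟨ ⊛-congˡ S (λ k → trans (⊕-⊛ 𝟙 q E k) (cong₂ _+_ (𝟙⊛ E k) (q⊛ E k))) j ⟩
    ((E ⊕ shift E) ⊛ S) j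
  ≡⟨ ⊕-⊛ E (shift E) S j ⟩
    (E ⊛ S) j + (shift E ⊛ S) j
  ≡⟨ cong₂ _+_ (sym (q[1+q]^⊛-shift n S (suc j))) (trans (shift-⊛ E S j) (sym (q[1+q]^⊛-shift n S j))) ⟩
    q[1+q]^⊛ n S (suc j) + q[1+q]^⊛ n S j ∎
  where
  open ≡-Reasoning
  E : Poly
  E = (𝟙 ⊕ q) ^ᵖ n

weightℓ : ∀ {r} → ℕ → ℕ → ℕ → Weight r
weightℓ x y ℓ = combo (λ i → coeffℓ x y ℓ (toℕ i))

weight₂ : ∀ {r} → ℕ → ℕ → Weight r
weight₂ a b = combo (λ i → coeff₂ a b (toℕ i))

coord-weightℓ : ∀ {r} x y ℓ m → m < r → coord m (weightℓ {r} x y ℓ) ≡ + coeffℓ x y ℓ m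
coord-weightℓ x y ℓ = coord-combo (coeffℓ x y ℓ)

coord-weight₂ : ∀ {r} a b m → m < r → coord m (weight₂ {r} a b) ≡ + coeff₂ a b m
coord-weight₂ a b = coord-combo (coeff₂ a b)

coeffℓ-suc-below : ∀ x y ℓ m → m < ℓ → coeffℓ x y (suc ℓ) m ≡ coeffℓ x y ℓ m
coeffℓ-suc-below x y ℓ zero _ = refl
coeffℓ-suc-below x y ℓ (suc zero) _ = refl
coeffℓ-suc-below x y ℓ (suc (suc k)) m<ℓ rewrite <ᵇ-true m<ℓ | <ᵇ-true (NP.m≤n⇒m≤1+n m<ℓ) = refl

coeffℓ-top : ∀ x y ℓ → 2 ≤ ℓ → coeffℓ x y (suc ℓ) ℓ ≡ 1
coeffℓ-top x y (suc (suc k)) (s≤s (s≤s z≤n)) rewrite <ᵇ-true (NP.≤-refl {suc (suc (suc k))}) = refl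

coeffℓ-above : ∀ x y ℓ m → 2 ≤ m → ℓ ≤ m → coeffℓ x y ℓ m ≡ 0
coeffℓ-above x y ℓ (suc (suc k)) (s≤s (s≤s z≤n)) ℓ≤m rewrite <ᵇ-false ℓ≤m = refl

coeffℓ-≤1 : ∀ x y ℓ m → 2 ≤ m → coeffℓ x y ℓ m ≤ 1
coeffℓ-≤1 x y ℓ (suc (suc k)) (s≤s (s≤s z≤n)) with suc (suc k) <ᵇ ℓ
... | true = NP.≤-refl
... | false = z≤n

weightℓ-suc : ∀ {r} x y ℓ → 2 ≤ ℓ → weightℓ {r} x y (suc ℓ) ≡ weightℓ x y ℓ ⊕ʷ αₙ ℓ
weightℓ-suc {r} x y ℓ 2≤ℓ = coord-injective _ _ λ m m<r → begin
    coord m (W (suc ℓ))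
  ≡⟨ coord-weightℓ x y (suc ℓ) m m<r ⟩
    + coeffℓ x y (suc ℓ) m
  ≡⟨ by-cases m m<r ⟩
    + coeffℓ x y ℓ m Z.+ (coord m (εₙ {r} ℓ) Z.- coord m (εₙ {r} (suc ℓ)))
  ≡⟨ cong₂ Z._+_ (sym (coord-weightℓ x y ℓ m m<r)) (sym (coord-⊖ m (εₙ {r} ℓ) (εₙ (suc ℓ)))) ⟩
    coord m (W ℓ) Z.+ coord m (αₙ {r} ℓ)
  ≡⟨ coord-⊕ m (W ℓ) (αₙ ℓ) ⟨
    coord m (W ℓ ⊕ʷ αₙ ℓ) ∎
  where
  open ≡-Reasoning
  W : ℕ → Weight r
  W = weightℓ x y
  by-cases : ∀ m → m < r → + coeffℓ x y (suc ℓ) m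
    ≡ + coeffℓ x y ℓ m Z.+ (coord m (εₙ {r} ℓ) Z.- coord m (εₙ {r} (suc ℓ)))
  by-cases m m<r with NP.<-cmp m ℓ
  ... | tri< m<ℓ _ _ rewrite coeffℓ-suc-below x y ℓ m m<ℓ | coord-εₙ-> {r} m ℓ m<ℓ
    | coord-εₙ-> {r} m (suc ℓ) (NP.m≤n⇒m≤1+n m<ℓ) = sym (ZP.+-identityʳ _)
  ... | tri≈ _ refl _ rewrite coeffℓ-top x y m 2≤ℓ | coeffℓ-above x y m m 2≤ℓ NP.≤-refl
    | coord-εₙ-≤ {r} m m NP.≤-refl m<r | coord-εₙ-> {r} m (suc m) NP.≤-refl = refl
  ... | tri> _ _ ℓ<m rewrite coeffℓ-above x y (suc ℓ) m (NP.≤-trans 2≤ℓ (NP.<⇒≤ ℓ<m)) ℓ<m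
    | coeffℓ-above x y ℓ m (NP.≤-trans 2≤ℓ (NP.<⇒≤ ℓ<m)) (NP.<⇒≤ ℓ<m)
    | coord-εₙ-≤ {r} m ℓ (NP.<⇒≤ ℓ<m) m<r | coord-εₙ-≤ {r} m (suc ℓ) ℓ<m m<r = refl

weightℓ-suc-⊖-rootA : ∀ {r} x y ℓ i → 2 ≤ ℓ →
  weightℓ {r} x y (suc ℓ) ⊖ʷ rootA i (suc ℓ) ≡ weightℓ x y ℓ ⊖ʷ rootA i ℓ
weightℓ-suc-⊖-rootA x y ℓ i 2≤ℓ = trans (cong (_⊖ʷ rootA i (suc ℓ)) (weightℓ-suc x y ℓ 2≤ℓ))
  (⊕-⊖-telescope (weightℓ x y ℓ) (εₙ ℓ) (εₙ (suc ℓ)) (εₙ i))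

sum-upTo-suc : ∀ n (f : ℕ → ℕ) → sum (L.map f (L.upTo (suc n))) ≡ sum (L.map f (L.upTo n)) + f n
sum-upTo-suc n f = begin
    sum (L.map f (L.upTo (suc n)))
  ≡⟨ cong (sum ∘ L.map f) (sym (LP.upTo-∷ʳ n)) ⟩
    sum (L.map f (L.upTo n ++ n ∷ []))
  ≡⟨ cong sum (LP.map-++ f (L.upTo n) (n ∷ [])) ⟩
    sum (L.map f (L.upTo n) ++ f n ∷ [])
  ≡⟨ sum-++ (L.map f (L.upTo n)) (f n ∷ []) ⟩
    sum (L.map f (L.upTo n)) + (f n + 0)
  ≡⟨ cong (_+_ (sum (L.map f (L.upTo n)))) (NP.+-identityʳ (f n)) ⟩
    sum (L.map f (L.upTo n)) + f n ∎
  where open ≡-Reasoning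

coord-weightℓ-top : ∀ {r} x y ℓ → 2 ≤ ℓ → ℓ < r → coord ℓ (weightℓ {r} x y (suc ℓ)) ≡ + 1
coord-weightℓ-top x y ℓ 2≤ℓ ℓ<r = trans (coord-weightℓ x y (suc ℓ) ℓ ℓ<r) (cong +_ (coeffℓ-top x y ℓ 2≤ℓ))

ways-rootsA-step : ∀ {r} x y ℓ j → 2 ≤ ℓ → suc (suc ℓ) ≤ r →
  ways (rootsA (suc (suc ℓ))) (suc j) (weightℓ {r} x y (suc (suc ℓ)))
  ≡ ways (rootsA (suc ℓ)) (suc j) (weightℓ x y (suc ℓ)) + ways (rootsA (suc ℓ)) j (weightℓ x y (suc ℓ))
ways-rootsA-step {r} x y ℓ j 2≤ℓ ℓ+1<r = begin
    ways (rootsA (suc ℓ′)) (suc j) (W (suc ℓ′))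
  ≡⟨ ways-rootsA-suc ℓ′ j (W (suc ℓ′)) ℓ+1<r (coord-weightℓ-top x y ℓ′ 2≤ℓ′ ℓ+1<r) ⟩
    sum (L.map through (L.upTo (suc ℓ′)))
  ≡⟨ sum-upTo-suc ℓ′ through ⟩
    sum (L.map through (L.upTo ℓ′)) + through ℓ′
  ≡⟨ cong₂ _+_ (cong sum (LP.map-cong-local (All-upTo ℓ′ through-below))) through-top ⟩
    sum (L.map (λ i → ways (rootsA ℓ) j (W ℓ′ ⊖ʷ rootA i ℓ′)) (L.upTo ℓ′)) + ways (rootsA ℓ′) j (W ℓ′)
  ≡⟨ cong (_+ ways (rootsA ℓ′) j (W ℓ′)) (ways-rootsA-suc ℓ j (W ℓ′) ℓ<r (coord-weightℓ-top x y ℓ 2≤ℓ ℓ<r)) ⟨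
    ways (rootsA ℓ′) (suc j) (W ℓ′) + ways (rootsA ℓ′) j (W ℓ′) ∎
  where
  open ≡-Reasoning
  ℓ′ : ℕ
  ℓ′ = suc ℓ
  2≤ℓ′ : 2 ≤ ℓ′
  2≤ℓ′ = NP.m≤n⇒m≤1+n 2≤ℓ
  ℓ<r : ℓ < r
  ℓ<r = NP.<-trans NP.≤-refl ℓ+1<r
  W : ℕ → Weight r
  W = weightℓ x y
  through : ℕ → ℕ
  through i = ways (rootsA ℓ′) j (W (suc ℓ′) ⊖ʷ rootA i (suc ℓ′))
  through-top : through ℓ′ ≡ ways (rootsA ℓ′) j (W ℓ′)
  through-top = cong (ways (rootsA ℓ′) j)
    (trans (weightℓ-suc-⊖-rootA x y ℓ′ ℓ′ 2≤ℓ′) (⊖-[⊖-self] (W ℓ′) (εₙ ℓ′)))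
  through-below : ∀ {i} → i < ℓ′ → through i ≡ ways (rootsA ℓ) j (W ℓ′ ⊖ʷ rootA i ℓ′)
  through-below {i} i≤ℓ = begin
      through i
    ≡⟨ cong (ways (rootsA ℓ′) j) (weightℓ-suc-⊖-rootA x y ℓ′ i 2≤ℓ′) ⟩
      ways (rootsA ℓ′) j ξ
    ≡⟨ cong (λ L → ways L j ξ) (LP.++-identityʳ (rootsA ℓ′)) ⟨
      ways (rootsA ℓ′ ++ []) j ξ
    ≡⟨ ways-drop-column ℓ [] ξ j ℓ<r [] (ZP.≤-reflexive ξₗ≡0) ⟩
      ways (rootsA ℓ ++ []) j ξ
    ≡⟨ cong (λ L → ways L j ξ) (LP.++-identityʳ (rootsA ℓ)) ⟩
      ways (rootsA ℓ) j ξ ∎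
    where
    ξ : Weight r
    ξ = W ℓ′ ⊖ʷ rootA i ℓ′
    ξₗ≡0 : coord ℓ ξ ≡ + 0
    ξₗ≡0 = trans (coord-⊖ ℓ (W ℓ′) (rootA i ℓ′))
      (cong₂ Z._-_ (coord-weightℓ-top x y ℓ 2≤ℓ ℓ<r) (coord-rootA-∈ {r} ℓ i ℓ′ (NP.≤-pred i≤ℓ) NP.≤-refl ℓ<r))

coord-rootA : ∀ {r} m i k → m < r → coord m (rootA {r} i k) ≡ [ i ≤ m ] Z.- [ k ≤ m ]
coord-rootA {r} m i k m<r =
  trans (coord-⊖ m (εₙ {r} i) (εₙ k)) (cong₂ Z._-_ (coord-εₙ m i m<r) (coord-εₙ m k m<r))

weight₃-⊖-rootA : ∀ {r} x y i a b →
  (∀ m → + coeffℓ x y 3 m Z.- ([ i ≤ m ] Z.- [ 3 ≤ m ]) ≡ + coeff₂ a b m) →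
  weightℓ {r} x y 3 ⊖ʷ rootA i 3 ≡ weight₂ a b
weight₃-⊖-rootA {r} x y i a b coeffs = coord-injective _ _ λ m m<r → begin
    coord m (weightℓ {r} x y 3 ⊖ʷ rootA i 3)
  ≡⟨ coord-⊖ m (weightℓ {r} x y 3) (rootA i 3) ⟩
    coord m (weightℓ {r} x y 3) Z.- coord m (rootA {r} i 3)
  ≡⟨ cong₂ Z._-_ (coord-weightℓ x y 3 m m<r) (coord-rootA m i 3 m<r) ⟩
    + coeffℓ x y 3 m Z.- ([ i ≤ m ] Z.- [ 3 ≤ m ])
  ≡⟨ coeffs m ⟩
    + coeff₂ a b m
  ≡⟨ coord-weight₂ a b m m<r ⟨
    coord m (weight₂ {r} a b) ∎
  where open ≡-Reasoning

⟨,⟩≡ways-rootsA₂ : ∀ {r} a b j → 3 ≤ r → ⟨_,_⟩ {r} a b j ≡ ways (rootsA 2) j (weight₂ {r} a b)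
⟨,⟩≡ways-rootsA₂ {suc r} a b j (s≤s 2≤r) =
  ways-posRoots-rootsA 2 (weight₂ a b) j (NP.m≤n⇒m≤1+n 2≤r) coord-beyond-2≤0
    (ZP.≤-trans (ZP.≤-reflexive (coord-weight₂ a b r NP.≤-refl)) (Z.+≤+ (coeff₂≤1 r 2≤r)))
  where
  coord-beyond-2≤0 : ∀ m → 2 ≤ m → m < suc r → coord m (weight₂ {suc r} a b) Z.≤ + 0
  coord-beyond-2≤0 (suc (suc m)) (s≤s (s≤s z≤n)) m<r = ZP.≤-reflexive (coord-weight₂ a b (suc (suc m)) m<r)
  coeff₂≤1 : ∀ m → 2 ≤ m → coeff₂ a b m ≤ 1
  coeff₂≤1 (suc (suc m)) (s≤s (s≤s z≤n)) = z≤n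

bracketSum : ∀ {r} → ℕ → ℕ → Poly
bracketSum {r} x y = (⟨_,_⟩ {r} x y ⊕ ⟨_,_⟩ {r} (suc x) y) ⊕ ⟨_,_⟩ {r} (suc x) (suc y)

ways-rootsA-base : ∀ {r} x y j → 3 ≤ r → ways (rootsA 3) (suc j) (weightℓ {r} (suc x) (suc y) 3)
  ≡ bracketSum {r} x y j
ways-rootsA-base {r} x y j 3≤r = begin
    ways (rootsA 3) (suc j) W
  ≡⟨ ways-rootsA-suc 2 j W 3≤r (coord-weightℓ (suc x) (suc y) 3 2 3≤r) ⟩
    through 0 + (through 1 + (through 2 + 0))
  ≡⟨ cong₂ _+_ (cong (ways (rootsA 2) j) through-0)
      (cong₂ (λ a b → a + (b + 0)) (cong (ways (rootsA 2) j) through-1) (cong (ways (rootsA 2) j) through-2)) ⟩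
    ways (rootsA 2) j (weight₂ x y)
      + (ways (rootsA 2) j (weight₂ (suc x) y) + (ways (rootsA 2) j (weight₂ (suc x) (suc y)) + 0))
  ≡⟨ cong₂ _+_ (⟨,⟩≡ways-rootsA₂ x y j 3≤r)
      (cong₂ (λ a b → a + (b + 0)) (⟨,⟩≡ways-rootsA₂ (suc x) y j 3≤r) (⟨,⟩≡ways-rootsA₂ (suc x) (suc y) j 3≤r)) ⟨
    ⟨_,_⟩ {r} x y j + (⟨_,_⟩ {r} (suc x) y j + (⟨_,_⟩ {r} (suc x) (suc y) j + 0))
  ≡⟨ cong (λ t → ⟨_,_⟩ {r} x y j + (⟨_,_⟩ {r} (suc x) y j + t)) (NP.+-identityʳ _) ⟩
    ⟨_,_⟩ {r} x y j + (⟨_,_⟩ {r} (suc x) y j + ⟨_,_⟩ {r} (suc x) (suc y) j)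
  ≡⟨ NP.+-assoc (⟨_,_⟩ {r} x y j) _ _ ⟨
    bracketSum {r} x y j ∎
  where
  open ≡-Reasoning
  W : Weight r
  W = weightℓ (suc x) (suc y) 3
  through : ℕ → ℕ
  through i = ways (rootsA 2) j (W ⊖ʷ rootA i 3)
  through-0 : W ⊖ʷ rootA 0 3 ≡ weight₂ x y
  through-0 = weight₃-⊖-rootA (suc x) (suc y) 0 x y λ
    { 0 → refl ; 1 → refl ; 2 → refl ; (suc (suc (suc _))) → refl }
  through-1 : W ⊖ʷ rootA 1 3 ≡ weight₂ (suc x) y
  through-1 = weight₃-⊖-rootA (suc x) (suc y) 1 (suc x) y λ
    { 0 → ZP.+-identityʳ _ ; 1 → refl ; 2 → refl ; (suc (suc (suc _))) → refl }
  through-2 : W ⊖ʷ rootA 2 3 ≡ weight₂ (suc x) (suc y)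
  through-2 = weight₃-⊖-rootA (suc x) (suc y) 2 (suc x) (suc y) λ
    { 0 → ZP.+-identityʳ _ ; 1 → ZP.+-identityʳ _ ; 2 → refl ; (suc (suc (suc _))) → refl }

ways-rootsA-zero : ∀ {r} x y ℓ → 0 < r → ways (rootsA ℓ) 0 (weightℓ {r} (suc x) y ℓ) ≡ 0
ways-rootsA-zero {r} x y ℓ 0<r = trans (ways-zero (rootsA ℓ) _)
  (ways-coord-≢0 [] 0 _ 0 [] (λ W₀≡0 → suc≢0 (trans (sym (coord-weightℓ (suc x) y ℓ 0 0<r)) W₀≡0)))
  where
  suc≢0 : + suc x ≢ + 0
  suc≢0 ()

ways-rootsA-weightℓ : ∀ {r} x y n j → 3 + n ≤ r →
  ways (rootsA (3 + n)) j (weightℓ {r} (suc x) (suc y) (3 + n))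
  ≡ q[1+q]^⊛ n (bracketSum {r} x y) j
ways-rootsA-weightℓ {r} x y n zero ℓ≤r =
  trans (ways-rootsA-zero x (suc y) (3 + n) (NP.≤-trans (s≤s z≤n) ℓ≤r))
        (sym (q[1+q]^⊛-zero n (bracketSum {r} x y)))
ways-rootsA-weightℓ {r} x y zero (suc j) ℓ≤r =
  trans (ways-rootsA-base x y j ℓ≤r) (sym (q[1+q]^0⊛-suc (bracketSum {r} x y) j))
ways-rootsA-weightℓ {r} x y (suc n) (suc j) ℓ≤r = begin
    ways (rootsA (4 + n)) (suc j) (weightℓ {r} (suc x) (suc y) (4 + n))
  ≡⟨ ways-rootsA-step (suc x) (suc y) (2 + n) j (s≤s (s≤s z≤n)) ℓ≤r ⟩
    ways (rootsA (3 + n)) (suc j) (weightℓ (suc x) (suc y) (3 + n))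
      + ways (rootsA (3 + n)) j (weightℓ (suc x) (suc y) (3 + n))
  ≡⟨ cong₂ _+_ (ways-rootsA-weightℓ x y n (suc j) 3+n≤r) (ways-rootsA-weightℓ x y n j 3+n≤r) ⟩
    q[1+q]^⊛ n (bracketSum {r} x y) (suc j) + q[1+q]^⊛ n (bracketSum {r} x y) j
  ≡⟨ q[1+q]^suc⊛-suc n (bracketSum {r} x y) j ⟨
    q[1+q]^⊛ (suc n) (bracketSum {r} x y) (suc j) ∎
  where
  open ≡-Reasoning
  3+n≤r : 3 + n ≤ r
  3+n≤r = NP.≤-trans (NP.n≤1+n _) ℓ≤r

lemma5p3 : (r ℓ x y : ℕ) → 3 ≤ ℓ → ℓ ≤ r → 1 ≤ x → 1 ≤ y →
    (j : ℕ) →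
    ℘ r (combo (λ i → coeffℓ x y ℓ (toℕ i))) j
      ≡ ((q ⊛ ((𝟙 ⊕ q) ^ᵖ (ℓ ∸ 3)))
          ⊛ ((⟨_,_⟩ {r} (x ∸ 1) (y ∸ 1) ⊕ ⟨_,_⟩ {r} x (y ∸ 1)) ⊕ ⟨_,_⟩ {r} x y)) j
lemma5p3 zero _ _ _ (s≤s (s≤s (s≤s z≤n))) () _ _ _
lemma5p3 (suc r) ℓ@(suc (suc (suc n))) (suc x) (suc y) (s≤s (s≤s (s≤s z≤n))) ℓ≤r (s≤s z≤n) (s≤s z≤n) j =
  trans (ways-posRoots-rootsA ℓ (weightℓ (suc x) (suc y) ℓ) j ℓ≤r coord-beyond-ℓ≤0 last-coord≤1)
        (ways-rootsA-weightℓ x y n j ℓ≤r)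
  where
  coord-beyond-ℓ≤0 : ∀ m → ℓ ≤ m → m < suc r → coord m (weightℓ {suc r} (suc x) (suc y) ℓ) Z.≤ + 0
  coord-beyond-ℓ≤0 m ℓ≤m m<r = ZP.≤-reflexive (trans (coord-weightℓ (suc x) (suc y) ℓ m m<r)
    (cong +_ (coeffℓ-above (suc x) (suc y) ℓ m (NP.≤-trans (s≤s (s≤s z≤n)) ℓ≤m) ℓ≤m)))
  last-coord≤1 : coord r (weightℓ {suc r} (suc x) (suc y) ℓ) Z.≤ + 1
  last-coord≤1 = ZP.≤-trans (ZP.≤-reflexive (coord-weightℓ (suc x) (suc y) ℓ r NP.≤-refl))
    (Z.+≤+ (coeffℓ-≤1 (suc x) (suc y) ℓ r (NP.≤-pred (NP.≤-trans (s≤s (s≤s (s≤s z≤n))) ℓ≤r))))
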